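{- For every integer $k \geq 3$, $$g_1^*(k, k-2) \leq \frac{1}{6}\binom{k-2}{2} + 2k - 3.$$
   Context: For a $k$-uniform hypergraph $H$ with vertex set $V$ and $1 \le m \le k-1$: an $m$-matching is a set $M$ of edges with $|e \cap e'| < m$ for all distinct $e,e' \in M$, and $\nu^{(m)}(H)$ is its maximum size. A fractional $m$-cover is a function $c:\binom{V}{m} \to \mathbb{R}_{\ge 0}$ such that $\sum_{S \in \binom{e}{m}} c(S) \geq 1$ for every edge $e$; its size is $\sum_S c(S)$, and $\tau^{*(m)}(H)$ is the minimum size of a fractional $m$-cover. $g_1^*(k,m)$ is the supremum of $\tau^{*(m)}(H)/\nu^{(m)}(H)$ over all finite $k$-uniform hypergraphs $H$ with $\nu^{(m)}(H) = 1$. -}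

module Defs where

open import Data.Nat using (ℕ; zero; suc; _<_; _≤_; _∸_; _*_; _≟_)
open import Data.Nat.Combinatorics using (_C_)
open import Data.Bool using (true; false)
open import Data.Vec using ([]; _∷_)
open import Data.List using (List; []; _∷_; _++_; map; filter; foldr; length)
open import Data.List.Relation.Unary.All using (All)
open import Data.List.Relation.Unary.Unique.Propositional using (Unique)
open import Data.List.Membership.Propositional using (_∈_)
open import Data.Fin.Subset using (Subset; _∩_; _⊆_; ∣_∣)
open import Data.Fin.Subset.Properties using (_⊆?_)
open import Data.Integer using (+_)
open import Data.Rational using (ℚ; 0ℚ; 1ℚ; _+_; _/_) renaming (_≤_ to _≤ℚ_)
open import Data.Product using (_×_; Σ; ∃)
open import Relation.Binary.PropositionalEquality using (_≡_; _≢_)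
open import Relation.Nullary.Decidable using (_×-dec_)

allSubsets : (n : ℕ) → List (Subset n)
allSubsets zero = [] ∷ []
allSubsets (suc n) = map (true ∷_) (allSubsets n) ++ map (false ∷_) (allSubsets n)

mSubsets : {n : ℕ} → ℕ → List (Subset n)
mSubsets {n} m = filter (λ S → ∣ S ∣ ≟ m) (allSubsets n)

mSubsetsOf : {n : ℕ} → ℕ → Subset n → List (Subset n)
mSubsetsOf {n} m e = filter (λ S → (∣ S ∣ ≟ m) ×-dec (S ⊆? e)) (allSubsets n)

sumℚ : {n : ℕ} → (Subset n → ℚ) → List (Subset n) → ℚ
sumℚ c = foldr (λ S acc → c S + acc) 0ℚ

record UniformHypergraph (k : ℕ) : Set where
  field
    n       : ℕ
    edges   : List (Subset n)
    unique  : Unique edges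
    uniform : All (λ e → ∣ e ∣ ≡ k) edges

module _ {k : ℕ} (H : UniformHypergraph k) where
  open UniformHypergraph H

  IsMatching : ℕ → List (Subset n) → Set
  IsMatching m M =
    Unique M × All (_∈ edges) M ×
    (∀ {e e'} → e ∈ M → e' ∈ M → e ≢ e' → ∣ e ∩ e' ∣ < m)

  MatchingNumberOne : ℕ → Set
  MatchingNumberOne m =
    (Σ (List (Subset n)) λ M → IsMatching m M × length M ≡ 1) ×
    (∀ M → IsMatching m M → length M ≤ 1)

  -- fractional m-cover  c : binom(V,m) → ℚ≥0 (values off m-sets are ignored)
  IsFractionalCover : ℕ → (Subset n → ℚ) → Set
  IsFractionalCover m c =
    (∀ S → ∣ S ∣ ≡ m → 0ℚ ≤ℚ c S) ×
    All (λ e → 1ℚ ≤ℚ sumℚ c (mSubsetsOf m e)) edges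

  coverSize : ℕ → (Subset n → ℚ) → ℚ
  coverSize m c = sumℚ c (mSubsets m)

  -- τ^{*(m)}(H) ≤ b  (the minimum of the LP is attained, at a rational point)
  FracCoverNumberAtMost : ℕ → ℚ → Set
  FracCoverNumberAtMost m b =
    Σ (Subset n → ℚ) λ c → IsFractionalCover m c × coverSize m c ≤ℚ b

bound : ℕ → ℚ
bound k = (+ ((k ∸ 2) C 2) / 6) + (+ (2 * k ∸ 3) / 1)

{-# OPTIONS --safe #-}
module Submission where

-- Write k = t + 3, so m = k - 2 = t + 1. Since ν^(m) = 1, any two edges share at least t + 1
-- vertices. Fix an edge e. If no edge meets e in exactly t + 1 vertices, all edges meet a fixed
-- (t + 2)-subset K of e in at least t + 1 vertices, and weight 1 on the (t + 1)-subsets of K is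
-- a cover of size k - 1. Otherwise let |e ∩ e′| = t + 1 and put C = e ∩ e′ and D = e △ e′, so
-- |C| = t + 1 and |D| = 4. Every edge f then has |C ∩ f| = t + 1, or |C ∩ f| = t and
-- |D ∩ f| ≥ 2, or |C ∩ f| = t - 1 and D ⊆ f. All covers weight the m-sets S ⊆ C ∪ D according
-- to |S ∩ C| and |S ∩ D|. If no edge contains D, weight 1 on C and 1/2 on each set with t points
-- in C and one in D is a cover of size 2k - 3. If some edge g contains D, every edge meets D in
-- at least two points (as it meets g in t + 1), so the weight 1/2 alone covers the first two
-- kinds of edges, and the edges containing D are covered at cost at most 1 + (1/6) C(k-2, 2).

open import Defs
open import Data.Bool as Bool using (Bool; true; false; _∧_; _∨_; not)
open import Data.Bool.Properties using (∧-zeroʳ; ∧-identityʳ)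
open import Data.Fin using (Fin; #_)
open import Data.Fin.Subset using (Subset; _∩_; _∪_; ∁; ⊥; ⊤; ∣_∣)
open import Data.Fin.Subset.Properties
  using (_⊆?_; anySubset?; ⊆⊤; ∩-identityʳ; ∩-zeroʳ; ∩-comm; ∩-idem; ∣p∩q∣≤∣p∣)
open import Data.Integer as ℤ using (+_)
import Data.Integer.Properties as ℤ
open import Data.List using (List; []; _∷_; _++_; map; filter; foldr; length)
open import Data.List.Membership.Propositional using (_∈_; find)
open import Data.List.Properties using (foldr-map; foldr-cong)
open import Data.List.Relation.Unary.All as All using (All; []; _∷_)
open import Data.List.Relation.Unary.All.Properties using (¬Any⇒All¬)
open import Data.List.Relation.Unary.AllPairs using ([]; _∷_)
open import Data.List.Relation.Unary.Any using (here; there; any?)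
open import Data.Nat as ℕ using (ℕ; zero; suc; _+_; _*_; _∸_; _≤_; _<_; _>_; _≤?_; _≟_; _≡ᵇ_; z≤n; s≤s; NonZero)
import Data.Nat.Properties as ℕ
open import Data.Nat.Combinatorics using (_C_; nCk+nC[k+1]≡[n+1]C[k+1]; nCn≡1; nC1≡n; nCk≡nC[n∸k])
open import Data.Nat.Tactic.RingSolver using (solve-∀)
open import Data.Product using (_,_)
open import Data.Rational using (ℚ; 0ℚ; 1ℚ; _/_; toℚᵘ) renaming (_≤_ to _≤ℚ_; _+_ to _+ℚ_)
import Data.Rational.Properties as ℚ
import Data.Rational.Unnormalised as ℚᵘ
import Data.Rational.Unnormalised.Properties as ℚᵘ
open import Data.Vec as Vec using (Vec; []; _∷_; lookup; head; tail)
import Data.Vec.Properties as Vec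
open import Function using (_∘_)
open import Relation.Binary.PropositionalEquality
  using (_≡_; _≢_; refl; sym; trans; cong; cong₂; subst; subst₂; module ≡-Reasoning)
open import Relation.Nullary using (does; yes; no; ¬?; contradiction)
open import Relation.Nullary.Decidable using (_×-dec_; False; toWitnessFalse; decidable-stable; dec-true)
open import Relation.Unary using (Decidable)

open import Algebra.Properties.CommutativeSemigroup ℕ.+-commutativeSemigroup
  using () renaming (interchange to +-interchange)

indicator : Bool → ℕ
indicator true = 1
indicator false = 0

sumℕ : {A : Set} → (A → ℕ) → List A → ℕ
sumℕ h = foldr (λ x acc → h x + acc) 0

module _ {A : Set} where

  sumℕ-++ : (h : A → ℕ) (L L′ : List A) → sumℕ h (L ++ L′) ≡ sumℕ h L + sumℕ h L′
  sumℕ-++ h [] L′ = refl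
  sumℕ-++ h (x ∷ L) L′ = trans (cong (_+_ (h x)) (sumℕ-++ h L L′)) (sym (ℕ.+-assoc (h x) _ _))

  sumℕ-map : {B : Set} (h : B → ℕ) (g : A → B) (L : List A) → sumℕ h (map g L) ≡ sumℕ (h ∘ g) L
  sumℕ-map h g = foldr-map _ g 0

  sumℕ-cong : {h h′ : A → ℕ} → (∀ x → h x ≡ h′ x) → (L : List A) → sumℕ h L ≡ sumℕ h′ L
  sumℕ-cong h≗h′ = foldr-cong (λ x acc → cong (_+ acc) (h≗h′ x)) refl

  sumℕ-zero : (L : List A) → sumℕ (λ _ → 0) L ≡ 0
  sumℕ-zero [] = refl
  sumℕ-zero (x ∷ L) = sumℕ-zero L

  sumℕ-+ : (f g : A → ℕ) (L : List A) → sumℕ (λ x → f x + g x) L ≡ sumℕ f L + sumℕ g L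
  sumℕ-+ f g [] = refl
  sumℕ-+ f g (x ∷ L) = trans (cong (_+_ (f x + g x)) (sumℕ-+ f g L)) (+-interchange (f x) (g x) (sumℕ f L) (sumℕ g L))

  sumℕ-* : (c : ℕ) (f : A → ℕ) (L : List A) → sumℕ (λ x → c * f x) L ≡ c * sumℕ f L
  sumℕ-* c f [] = sym (ℕ.*-zeroʳ c)
  sumℕ-* c f (x ∷ L) = trans (cong (_+_ (c * f x)) (sumℕ-* c f L)) (sym (ℕ.*-distribˡ-+ c (f x) (sumℕ f L)))

  sumℕ-filter : {P : A → Set} (P? : Decidable P) (h : A → ℕ) (L : List A) →
    sumℕ h (filter P? L) ≡ sumℕ (λ x → h x * indicator (does (P? x))) L
  sumℕ-filter P? h [] = refl
  sumℕ-filter P? h (x ∷ L) with does (P? x)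
  ... | true = cong₂ _+_ (sym (ℕ.*-identityʳ (h x))) (sumℕ-filter P? h L)
  ... | false = trans (sumℕ-filter P? h L)
    (cong (_+ sumℕ (λ y → h y * indicator (does (P? y))) L) (sym (ℕ.*-zeroʳ (h x))))

sumℕ-allSubsets : ∀ {n} (h : Subset (suc n) → ℕ) →
  sumℕ h (allSubsets (suc n)) ≡ sumℕ (h ∘ (true ∷_)) (allSubsets n) + sumℕ (h ∘ (false ∷_)) (allSubsets n)
sumℕ-allSubsets {n} h = trans (sumℕ-++ h (map (true ∷_) (allSubsets n)) _)
  (cong₂ _+_ (sumℕ-map h (true ∷_) (allSubsets n)) (sumℕ-map h (false ∷_) (allSubsets n)))

toℚᵘ-/ : ∀ a d .{{_ : NonZero d}} → toℚᵘ (+ a / d) ℚᵘ.≃ (+ a) ℚᵘ./ d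
toℚᵘ-/ a (suc d) = ℚ.toℚᵘ-fromℚᵘ (ℚᵘ.mkℚᵘ (+ a) d)

/-≤ : ∀ a b d e .{{_ : NonZero d}} .{{_ : NonZero e}} → a * e ≤ b * d → + a / d ≤ℚ + b / e
/-≤ a b d@(suc _) e@(suc _) ae≤bd = ℚ.toℚᵘ-cancel-≤
  (ℚᵘ.≤-respˡ-≃ (ℚᵘ.≃-sym (toℚᵘ-/ a d)) (ℚᵘ.≤-respʳ-≃ (ℚᵘ.≃-sym (toℚᵘ-/ b e)) (ℚᵘ.*≤* cross)))
  where
  cross : + a ℤ.* + e ℤ.≤ + b ℤ.* + d
  cross = subst₂ ℤ._≤_ (ℤ.pos-* a e) (ℤ.pos-* b d) (ℤ.+≤+ ae≤bd)

/-≡ : ∀ a b d e .{{_ : NonZero d}} .{{_ : NonZero e}} → a * e ≡ b * d → + a / d ≡ + b / e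
/-≡ a b d e ae≡bd = ℚ.≤-antisym (/-≤ a b d e (ℕ.≤-reflexive ae≡bd)) (/-≤ b a e d (ℕ.≤-reflexive (sym ae≡bd)))

/-+ : ∀ a b d e .{{_ : NonZero d}} .{{_ : NonZero e}} →
  + a / d +ℚ + b / e ≡ (+ (a * e + b * d) / (d * e)) {{ℕ.m*n≢0 d e}}
/-+ a b d@(suc _) e@(suc _) = ℚ.toℚᵘ-injective (begin
  toℚᵘ (+ a / d +ℚ + b / e)               ≈⟨ ℚ.toℚᵘ-homo-+ (+ a / d) (+ b / e) ⟩
  toℚᵘ (+ a / d) ℚᵘ.+ toℚᵘ (+ b / e)     ≈⟨ ℚᵘ.+-cong (toℚᵘ-/ a d) (toℚᵘ-/ b e) ⟩
  (+ a ℚᵘ./ d) ℚᵘ.+ (+ b ℚᵘ./ e)         ≡⟨ cong (ℚᵘ._/ (d * e)) numerator ⟩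
  + (a * e + b * d) ℚᵘ./ (d * e)         ≈⟨ ℚᵘ.≃-sym (toℚᵘ-/ (a * e + b * d) (d * e)) ⟩
  toℚᵘ (+ (a * e + b * d) / (d * e))     ∎)
  where
  open import Relation.Binary.Reasoning.Setoid ℚᵘ.≃-setoid
  numerator : + a ℤ.* + e ℤ.+ + b ℤ.* + d ≡ + (a * e + b * d)
  numerator = trans (cong₂ ℤ._+_ (sym (ℤ.pos-* a e)) (sym (ℤ.pos-* b d))) (sym (ℤ.pos-+ (a * e) (b * d)))

a/d+b/d≡[a+b]/d : ∀ a b d .{{_ : NonZero d}} → + a / d +ℚ + b / d ≡ + (a + b) / d
a/d+b/d≡[a+b]/d a b d@(suc _) = trans (/-+ a b d d) (/-≡ (a * d + b * d) (a + b) (d * d) d (regroup a b d))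
  where
  regroup : ∀ a b d → (a * d + b * d) * d ≡ (a + b) * (d * d)
  regroup = solve-∀

sumℚ-/ : ∀ {n} (h : Subset n → ℕ) d .{{_ : NonZero d}} (L : List (Subset n)) →
  sumℚ (λ S → + h S / d) L ≡ + sumℕ h L / d
sumℚ-/ h d [] = sym (ℚ.0/n≡0 d)
sumℚ-/ h d (S ∷ L) = trans (cong (+ h S / d +ℚ_) (sumℚ-/ h d L)) (a/d+b/d≡[a+b]/d (h S) (sumℕ h L) d)

0≤/ : ∀ a d .{{_ : NonZero d}} → 0ℚ ≤ℚ + a / d
0≤/ a d = /-≤ 0 a 1 d z≤n

1≤/ : ∀ a d .{{_ : NonZero d}} → d ≤ a → 1ℚ ≤ℚ + a / d
1≤/ a d d≤a = /-≤ 1 a 1 d (subst₂ _≤_ (sym (ℕ.*-identityˡ d)) (sym (ℕ.*-identityʳ a)) d≤a)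

/≤bound : ∀ t x d .{{_ : NonZero d}} → x * 6 ≤ (suc t C 2 + (2 * t + 3) * 6) * d → + x / d ≤ℚ bound (3 + t)
/≤bound t x d x≤ = subst (+ x / d ≤ℚ_) (sym (/-+ (suc t C 2) (2 * (3 + t) ∸ 3) 6 1))
  (/-≤ x ((suc t C 2) * 1 + (2 * (3 + t) ∸ 3) * 6) d 6 (subst (x * 6 ≤_) (regroup (suc t C 2) t d) x≤))
  where
  regroup : ∀ c t d → (c + (2 * t + 3) * 6) * d ≡ (c * 1 + (t + (3 + (t + 0))) * 6) * d
  regroup = solve-∀

-- Cardinalities of Boolean combinations of subsets

infix  9 ∣_∣ᶠ
infixr 7 _∩ᶠ_
infixr 6 _∪ᶠ_
infixr 5 _⊕_

data Formula (r : ℕ) : Set where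
  var : Fin r → Formula r
  ⊥ᶠ : Formula r
  ∁ᶠ : Formula r → Formula r
  _∩ᶠ_ _∪ᶠ_ : Formula r → Formula r → Formula r

data CardSum (r : ℕ) : Set where
  ∣_∣ᶠ : Formula r → CardSum r
  _⊕_ : CardSum r → CardSum r → CardSum r

module _ {r : ℕ} where

  ⟦_⟧ : ∀ {n} → Formula r → Vec (Subset n) r → Subset n
  ⟦ var x ⟧ vs = lookup vs x
  ⟦ ⊥ᶠ ⟧ vs = ⊥
  ⟦ ∁ᶠ φ ⟧ vs = ∁ (⟦ φ ⟧ vs)
  ⟦ φ ∩ᶠ ψ ⟧ vs = ⟦ φ ⟧ vs ∩ ⟦ ψ ⟧ vs
  ⟦ φ ∪ᶠ ψ ⟧ vs = ⟦ φ ⟧ vs ∪ ⟦ ψ ⟧ vs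

  ⟦_⟧ᵇ : Formula r → Vec Bool r → Bool
  ⟦ var x ⟧ᵇ bs = lookup bs x
  ⟦ ⊥ᶠ ⟧ᵇ bs = false
  ⟦ ∁ᶠ φ ⟧ᵇ bs = not (⟦ φ ⟧ᵇ bs)
  ⟦ φ ∩ᶠ ψ ⟧ᵇ bs = ⟦ φ ⟧ᵇ bs ∧ ⟦ ψ ⟧ᵇ bs
  ⟦ φ ∪ᶠ ψ ⟧ᵇ bs = ⟦ φ ⟧ᵇ bs ∨ ⟦ ψ ⟧ᵇ bs

  card : ∀ {n} → CardSum r → Vec (Subset n) r → ℕ
  card ∣ φ ∣ᶠ vs = ∣ ⟦ φ ⟧ vs ∣
  card (s ⊕ s′) vs = card s vs + card s′ vs

  cardᵇ : CardSum r → Vec Bool r → ℕ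
  cardᵇ ∣ φ ∣ᶠ bs = indicator (⟦ φ ⟧ᵇ bs)
  cardᵇ (s ⊕ s′) bs = cardᵇ s bs + cardᵇ s′ bs

  private
    heads : ∀ {n} → Vec (Subset (suc n)) r → Vec Bool r
    heads = Vec.map head

    tails : ∀ {n} → Vec (Subset (suc n)) r → Vec (Subset n) r
    tails = Vec.map tail

    ⟦⟧-∷ : ∀ {n} (φ : Formula r) (vs : Vec (Subset (suc n)) r) → ⟦ φ ⟧ vs ≡ ⟦ φ ⟧ᵇ (heads vs) ∷ ⟦ φ ⟧ (tails vs)
    ⟦⟧-∷ (var x) vs rewrite Vec.lookup-map x head vs | Vec.lookup-map x tail vs = ∷-η (lookup vs x)
      where
      ∷-η : ∀ {m} (v : Subset (suc m)) → v ≡ head v ∷ tail v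
      ∷-η (_ ∷ _) = refl
    ⟦⟧-∷ ⊥ᶠ vs = refl
    ⟦⟧-∷ (∁ᶠ φ) vs rewrite ⟦⟧-∷ φ vs = refl
    ⟦⟧-∷ (φ ∩ᶠ ψ) vs rewrite ⟦⟧-∷ φ vs | ⟦⟧-∷ ψ vs = refl
    ⟦⟧-∷ (φ ∪ᶠ ψ) vs rewrite ⟦⟧-∷ φ vs | ⟦⟧-∷ ψ vs = refl

    card-∷ : ∀ {n} (s : CardSum r) (vs : Vec (Subset (suc n)) r) → card s vs ≡ cardᵇ s (heads vs) + card s (tails vs)
    card-∷ ∣ φ ∣ᶠ vs rewrite ⟦⟧-∷ φ vs with ⟦ φ ⟧ᵇ (heads vs)
    ... | true = refl
    ... | false = refl
    card-∷ (s ⊕ s′) vs rewrite card-∷ s vs | card-∷ s′ vs =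
      +-interchange (cardᵇ s (heads vs)) (card s (tails vs)) (cardᵇ s′ (heads vs)) (card s′ (tails vs))

    card-[] : (s : CardSum r) (vs : Vec (Subset 0) r) → card s vs ≡ 0
    card-[] ∣ φ ∣ᶠ vs with ⟦ φ ⟧ vs
    ... | [] = refl
    card-[] (s ⊕ s′) vs rewrite card-[] s vs | card-[] s′ vs = refl

  card-mono : (s s′ : CardSum r) → (∀ bs → cardᵇ s bs ≤ cardᵇ s′ bs) →
    ∀ {n} (vs : Vec (Subset n) r) → card s vs ≤ card s′ vs
  card-mono s s′ pointwise {zero} vs rewrite card-[] s vs = z≤n
  card-mono s s′ pointwise {suc n} vs rewrite card-∷ s vs | card-∷ s′ vs =
    ℕ.+-mono-≤ (pointwise (heads vs)) (card-mono s s′ pointwise (tails vs))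

  ⟦⟧-cong : (φ ψ : Formula r) → (∀ bs → ⟦ φ ⟧ᵇ bs ≡ ⟦ ψ ⟧ᵇ bs) →
    ∀ {n} (vs : Vec (Subset n) r) → ⟦ φ ⟧ vs ≡ ⟦ ψ ⟧ vs
  ⟦⟧-cong φ ψ pointwise {zero} vs with ⟦ φ ⟧ vs | ⟦ ψ ⟧ vs
  ... | [] | [] = refl
  ⟦⟧-cong φ ψ pointwise {suc n} vs rewrite ⟦⟧-∷ φ vs | ⟦⟧-∷ ψ vs =
    cong₂ _∷_ (pointwise (heads vs)) (⟦⟧-cong φ ψ pointwise (tails vs))

  -- The implicit arguments below are proved by evaluation over all 2 ^ r points.

  card-≤ : (s s′ : CardSum r) → {False (anySubset? (λ bs → ¬? (cardᵇ s bs ≤? cardᵇ s′ bs)))} →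
    ∀ {n} (vs : Vec (Subset n) r) → card s vs ≤ card s′ vs
  card-≤ s s′ {noCounterexample} = card-mono s s′ λ bs →
    decidable-stable (_ ≤? _) (λ ≰ → toWitnessFalse noCounterexample (bs , ≰))

  card-≡ : (s s′ : CardSum r) → {False (anySubset? (λ bs → ¬? (cardᵇ s bs ≤? cardᵇ s′ bs)))} →
    {False (anySubset? (λ bs → ¬? (cardᵇ s′ bs ≤? cardᵇ s bs)))} →
    ∀ {n} (vs : Vec (Subset n) r) → card s vs ≡ card s′ vs
  card-≡ s s′ {≤} {≥} vs = ℕ.≤-antisym (card-≤ s s′ {≤} vs) (card-≤ s′ s {≥} vs)

  ⟦⟧-≡ : (φ ψ : Formula r) → {False (anySubset? (λ bs → ¬? (⟦ φ ⟧ᵇ bs Bool.≟ ⟦ ψ ⟧ᵇ bs)))} →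
    ∀ {n} (vs : Vec (Subset n) r) → ⟦ φ ⟧ vs ≡ ⟦ ψ ⟧ vs
  ⟦⟧-≡ φ ψ {noCounterexample} = ⟦⟧-cong φ ψ λ bs →
    decidable-stable (_ Bool.≟ _) (λ ≢ → toWitnessFalse noCounterexample (bs , ≢))

_△_ : ∀ {n} → Subset n → Subset n → Subset n
e △ e′ = (e ∩ ∁ e′) ∪ (e′ ∩ ∁ e)

module _ {n} (e e′ : Subset n) where
  private
    E E′ F G : Formula 4
    E = var (# 0)
    E′ = var (# 1)
    F = var (# 2)
    G = var (# 3)
    ⟨_,_⟩ : Subset n → Subset n → Vec (Subset n) 4
    ⟨ f , g ⟩ = e ∷ e′ ∷ f ∷ g ∷ []

  ∣e∩f∣≤∣e∩e′∩f∣+∣e∖e′∩f∣ : ∀ f → ∣ e ∩ f ∣ ≤ ∣ (e ∩ e′) ∩ f ∣ + ∣ (e ∩ ∁ e′) ∩ f ∣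
  ∣e∩f∣≤∣e∩e′∩f∣+∣e∖e′∩f∣ f = card-≤ ∣ E ∩ᶠ F ∣ᶠ (∣ (E ∩ᶠ E′) ∩ᶠ F ∣ᶠ ⊕ ∣ (E ∩ᶠ ∁ᶠ E′) ∩ᶠ F ∣ᶠ) ⟨ f , f ⟩

  ∣e′∩f∣≤∣e∩e′∩f∣+∣e′∖e∩f∣ : ∀ f → ∣ e′ ∩ f ∣ ≤ ∣ (e ∩ e′) ∩ f ∣ + ∣ (e′ ∩ ∁ e) ∩ f ∣
  ∣e′∩f∣≤∣e∩e′∩f∣+∣e′∖e∩f∣ f = card-≤ ∣ E′ ∩ᶠ F ∣ᶠ (∣ (E ∩ᶠ E′) ∩ᶠ F ∣ᶠ ⊕ ∣ (E′ ∩ᶠ ∁ᶠ E) ∩ᶠ F ∣ᶠ) ⟨ f , f ⟩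

  ∣e△e′∩f∣≡∣e∖e′∩f∣+∣e′∖e∩f∣ : ∀ f → ∣ (e △ e′) ∩ f ∣ ≡ ∣ (e ∩ ∁ e′) ∩ f ∣ + ∣ (e′ ∩ ∁ e) ∩ f ∣
  ∣e△e′∩f∣≡∣e∖e′∩f∣+∣e′∖e∩f∣ f =
    card-≡ ∣ ((E ∩ᶠ ∁ᶠ E′) ∪ᶠ (E′ ∩ᶠ ∁ᶠ E)) ∩ᶠ F ∣ᶠ (∣ (E ∩ᶠ ∁ᶠ E′) ∩ᶠ F ∣ᶠ ⊕ ∣ (E′ ∩ᶠ ∁ᶠ E) ∩ᶠ F ∣ᶠ) ⟨ f , f ⟩

  ∣e∖e′∩f∣+∣e∩e′∣≤∣e∣ : ∀ f → ∣ (e ∩ ∁ e′) ∩ f ∣ + ∣ e ∩ e′ ∣ ≤ ∣ e ∣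
  ∣e∖e′∩f∣+∣e∩e′∣≤∣e∣ f = card-≤ (∣ (E ∩ᶠ ∁ᶠ E′) ∩ᶠ F ∣ᶠ ⊕ ∣ E ∩ᶠ E′ ∣ᶠ) ∣ E ∣ᶠ ⟨ f , f ⟩

  ∣e′∖e∩f∣+∣e∩e′∣≤∣e′∣ : ∀ f → ∣ (e′ ∩ ∁ e) ∩ f ∣ + ∣ e ∩ e′ ∣ ≤ ∣ e′ ∣
  ∣e′∖e∩f∣+∣e∩e′∣≤∣e′∣ f = card-≤ (∣ (E′ ∩ᶠ ∁ᶠ E) ∩ᶠ F ∣ᶠ ⊕ ∣ E ∩ᶠ E′ ∣ᶠ) ∣ E′ ∣ᶠ ⟨ f , f ⟩

  ∣e△e′∣+2∣e∩e′∣≡∣e∣+∣e′∣ : ∣ e △ e′ ∣ + (∣ e ∩ e′ ∣ + ∣ e ∩ e′ ∣) ≡ ∣ e ∣ + ∣ e′ ∣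
  ∣e△e′∣+2∣e∩e′∣≡∣e∣+∣e′∣ =
    card-≡ (∣ (E ∩ᶠ ∁ᶠ E′) ∪ᶠ (E′ ∩ᶠ ∁ᶠ E) ∣ᶠ ⊕ ∣ E ∩ᶠ E′ ∣ᶠ ⊕ ∣ E ∩ᶠ E′ ∣ᶠ) (∣ E ∣ᶠ ⊕ ∣ E′ ∣ᶠ) ⟨ e , e ⟩

  e∩e′∩[e△e′]≡⊥ : (e ∩ e′) ∩ (e △ e′) ≡ ⊥
  e∩e′∩[e△e′]≡⊥ = ⟦⟧-≡ ((E ∩ᶠ E′) ∩ᶠ ((E ∩ᶠ ∁ᶠ E′) ∪ᶠ (E′ ∩ᶠ ∁ᶠ E))) ⊥ᶠ ⟨ e , e ⟩

  ∣f∩g∣+∣e△e′∩g∣≤∣g∣+∣e△e′∩f∣ : ∀ f g → ∣ f ∩ g ∣ + ∣ (e △ e′) ∩ g ∣ ≤ ∣ g ∣ + ∣ (e △ e′) ∩ f ∣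
  ∣f∩g∣+∣e△e′∩g∣≤∣g∣+∣e△e′∩f∣ f g = card-≤ (∣ F ∩ᶠ G ∣ᶠ ⊕ ∣ ((E ∩ᶠ ∁ᶠ E′) ∪ᶠ (E′ ∩ᶠ ∁ᶠ E)) ∩ᶠ G ∣ᶠ)
                                            (∣ G ∣ᶠ ⊕ ∣ ((E ∩ᶠ ∁ᶠ E′) ∪ᶠ (E′ ∩ᶠ ∁ᶠ E)) ∩ᶠ F ∣ᶠ) ⟨ f , g ⟩

dropFirst : ∀ {n} → Subset n → Subset n
dropFirst [] = []
dropFirst (true ∷ p) = false ∷ p
dropFirst (false ∷ p) = false ∷ dropFirst p

∣dropFirst∣ : ∀ {n} (p : Subset n) → 1 ≤ ∣ p ∣ → suc ∣ dropFirst p ∣ ≡ ∣ p ∣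
∣dropFirst∣ (true ∷ p) _ = refl
∣dropFirst∣ (false ∷ p) 1≤∣p∣ = ∣dropFirst∣ p 1≤∣p∣

∣p∩q∣≤1+∣dropFirst[p]∩q∣ : ∀ {n} (p q : Subset n) → ∣ p ∩ q ∣ ≤ suc ∣ dropFirst p ∩ q ∣
∣p∩q∣≤1+∣dropFirst[p]∩q∣ [] [] = z≤n
∣p∩q∣≤1+∣dropFirst[p]∩q∣ (true ∷ p) (true ∷ q) = ℕ.≤-refl
∣p∩q∣≤1+∣dropFirst[p]∩q∣ (true ∷ p) (false ∷ q) = ℕ.n≤1+n _
∣p∩q∣≤1+∣dropFirst[p]∩q∣ (false ∷ p) (_ ∷ q) = ∣p∩q∣≤1+∣dropFirst[p]∩q∣ p q

k≤n⇒nCk>0 : ∀ {n k} → k ≤ n → n C k > 0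
k≤n⇒nCk>0 {k = zero} _ = ℕ.≤-refl
k≤n⇒nCk>0 {suc n} {suc k} (s≤s k≤n) =
  subst (_> 0) (nCk+nC[k+1]≡[n+1]C[k+1] n k) (ℕ.≤-trans (k≤n⇒nCk>0 k≤n) (ℕ.m≤m+n (n C k) _))

[1+n]Cn≡1+n : ∀ n → suc n C n ≡ suc n
[1+n]Cn≡1+n n = begin
  suc n C n             ≡⟨ nCk≡nC[n∸k] (ℕ.n≤1+n n) ⟩
  suc n C (suc n ∸ n)   ≡⟨ cong (suc n C_) (ℕ.m+n∸n≡m 1 n) ⟩
  suc n C 1             ≡⟨ nC1≡n (suc n) ⟩
  suc n                 ∎
  where open ≡-Reasoning

[k+a]Ca≡[k+a]Ck : ∀ k a → (k + a) C a ≡ (k + a) C k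
[k+a]Ca≡[k+a]Ck k a = trans (nCk≡nC[n∸k] (ℕ.m≤n+m a k)) (cong ((k + a) C_) (ℕ.m+n∸n≡m k a))

[1+k]*[1+n]C[1+k]≡[1+n]*nCk : ∀ n k → suc k * (suc n C suc k) ≡ suc n * (n C k)
[1+k]*[1+n]C[1+k]≡[1+n]*nCk zero zero = refl
[1+k]*[1+n]C[1+k]≡[1+n]*nCk zero (suc k) = ℕ.*-zeroʳ (suc (suc k))
[1+k]*[1+n]C[1+k]≡[1+n]*nCk (suc n) zero = trans (ℕ.*-identityˡ _) (trans (nC1≡n (suc (suc n))) (sym (ℕ.*-identityʳ _)))
[1+k]*[1+n]C[1+k]≡[1+n]*nCk (suc n) (suc k) = begin
  suc K * (suc N C suc K)                       ≡⟨ cong (suc K *_) (sym (nCk+nC[k+1]≡[n+1]C[k+1] N K)) ⟩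
  suc K * ((N C K) + (N C suc K))               ≡⟨ regroup K (N C K) (N C suc K) ⟩
  N C K + (K * (N C K) + suc K * (N C suc K))   ≡⟨ cong (λ x → N C K + x) (cong₂ _+_ ([1+k]*[1+n]C[1+k]≡[1+n]*nCk n k)
                                                                                      ([1+k]*[1+n]C[1+k]≡[1+n]*nCk n K)) ⟩
  N C K + (N * (n C k) + N * (n C K))           ≡⟨ cong (λ x → N C K + x) (sym (ℕ.*-distribˡ-+ N (n C k) (n C K))) ⟩
  N C K + N * (n C k + n C K)                   ≡⟨ cong (λ x → N C K + N * x) (nCk+nC[k+1]≡[n+1]C[k+1] n k) ⟩
  N C K + N * (N C K)                           ∎
  where
  open ≡-Reasoning
  N = suc n
  K = suc k
  regroup : ∀ k x y → suc k * (x + y) ≡ x + (k * x + suc k * y)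
  regroup = solve-∀

6*[4+a]C4≡[4+a]C2*[2+a]C2 : ∀ a → 6 * ((4 + a) C 4) ≡ ((4 + a) C 2) * ((2 + a) C 2)
6*[4+a]C4≡[4+a]C2*[2+a]C2 a = ℕ.*-cancelˡ-≡ _ _ 2 (begin
  2 * (6 * c₄)                  ≡⟨ twelve c₄ ⟩
  3 * (4 * c₄)                  ≡⟨ cong (3 *_) ([1+k]*[1+n]C[1+k]≡[1+n]*nCk (3 + a) 3) ⟩
  3 * ((4 + a) * c₃)            ≡⟨ swap (4 + a) c₃ ⟩
  (4 + a) * (3 * c₃)            ≡⟨ cong ((4 + a) *_) ([1+k]*[1+n]C[1+k]≡[1+n]*nCk (2 + a) 2) ⟩
  (4 + a) * ((3 + a) * c₂)      ≡⟨ ℕ.*-assoc (4 + a) (3 + a) c₂ ⟨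
  ((4 + a) * (3 + a)) * c₂      ≡⟨ cong (_* c₂) (sym pairs) ⟩
  (2 * c₂′) * c₂                ≡⟨ ℕ.*-assoc 2 c₂′ c₂ ⟩
  2 * (c₂′ * c₂)                ∎)
  where
  open ≡-Reasoning
  c₄ = (4 + a) C 4
  c₃ = (3 + a) C 3
  c₂ = (2 + a) C 2
  c₂′ = (4 + a) C 2
  pairs : 2 * c₂′ ≡ (4 + a) * (3 + a)
  pairs = trans ([1+k]*[1+n]C[1+k]≡[1+n]*nCk (3 + a) 1) (cong ((4 + a) *_) (nC1≡n (3 + a)))
  twelve : ∀ x → 2 * (6 * x) ≡ 3 * (4 * x)
  twelve = solve-∀
  swap : ∀ x y → 3 * (x * y) ≡ x * (3 * y)
  swap = solve-∀

-- Split sets and covers built from them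

split : ∀ {n} (X Y : Subset n) (i j : ℕ) → Subset n → ℕ
split X Y i j S = indicator ((∣ S ∩ X ∣ ≡ᵇ i) ∧ (∣ S ∩ Y ∣ ≡ᵇ j) ∧ does (S ⊆? X ∪ Y))

splitOfSizeIn : ∀ {n} (E X Y : Subset n) (i j m : ℕ) → Subset n → ℕ
splitOfSizeIn E X Y i j m S = split X Y i j S * indicator (does ((∣ S ∣ ≟ m) ×-dec (S ⊆? E)))

sumℕ-splitOfSizeIn : ∀ n (E X Y : Subset n) i j m → X ∩ Y ≡ ⊥ → i + j ≡ m →
  sumℕ (splitOfSizeIn E X Y i j m) (allSubsets n) ≡ (∣ X ∩ E ∣ C i) * (∣ Y ∩ E ∣ C j)
sumℕ-splitOfSizeIn zero [] [] [] zero zero .0 _ refl = refl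
sumℕ-splitOfSizeIn zero [] [] [] zero (suc j) _ _ _ = refl
sumℕ-splitOfSizeIn zero [] [] [] (suc i) j _ _ _ = refl
sumℕ-splitOfSizeIn (suc n) (e ∷ E) (x ∷ X) (y ∷ Y) i j m disjoint i+j≡m =
  trans (sumℕ-allSubsets (splitOfSizeIn (e ∷ E) (x ∷ X) (y ∷ Y) i j m)) (newPoint x y e i j m disjoint i+j≡m)
  where
  A = allSubsets n
  IH : ∀ i j m → i + j ≡ m → sumℕ (splitOfSizeIn E X Y i j m) A ≡ (∣ X ∩ E ∣ C i) * (∣ Y ∩ E ∣ C j)
  IH i j m = sumℕ-splitOfSizeIn n E X Y i j m (cong tail disjoint)

  vanishing : ∀ {w : Subset n → ℕ} {c} → (∀ S → w S ≡ 0) → sumℕ w A + c ≡ c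
  vanishing w≗0 = cong (_+ _) (trans (sumℕ-cong w≗0 A) (sumℕ-zero A))

  ∧-false : ∀ a b → a ∧ b ∧ false ≡ false
  ∧-false a b rewrite ∧-zeroʳ b = ∧-zeroʳ a

  outsideE : ∀ c a → c * indicator (a ∧ false) ≡ 0
  outsideE c a rewrite ∧-zeroʳ a = ℕ.*-zeroʳ c

  newPoint : ∀ x y e i j m → (x ∷ X) ∩ (y ∷ Y) ≡ ⊥ → i + j ≡ m →
    sumℕ (splitOfSizeIn (e ∷ E) (x ∷ X) (y ∷ Y) i j m ∘ (true ∷_)) A + sumℕ (splitOfSizeIn E X Y i j m) A
      ≡ (∣ (x ∷ X) ∩ (e ∷ E) ∣ C i) * (∣ (y ∷ Y) ∩ (e ∷ E) ∣ C j)
  newPoint true true e i j m () _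
  newPoint false false e i j m _ i+j≡m =
    trans (vanishing λ S → cong (λ b → indicator b * _) (∧-false (∣ S ∩ X ∣ ≡ᵇ i) (∣ S ∩ Y ∣ ≡ᵇ j))) (IH i j m i+j≡m)
  newPoint true false false i j m _ i+j≡m =
    trans (vanishing λ S → outsideE (split (true ∷ X) (false ∷ Y) i j (true ∷ S)) (suc ∣ S ∣ ≡ᵇ m)) (IH i j m i+j≡m)
  newPoint false true false i j m _ i+j≡m =
    trans (vanishing λ S → outsideE (split (false ∷ X) (true ∷ Y) i j (true ∷ S)) (suc ∣ S ∣ ≡ᵇ m)) (IH i j m i+j≡m)
  newPoint true false true zero j m _ i+j≡m = trans (vanishing λ S → refl) (IH zero j m i+j≡m)
  newPoint true false true (suc i) j zero _ ()
  newPoint true false true (suc i) j (suc m) _ i+j≡m =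
    trans (cong₂ _+_ (IH i j m (ℕ.suc-injective i+j≡m)) (IH (suc i) j (suc m) i+j≡m))
          (trans (sym (ℕ.*-distribʳ-+ (∣ Y ∩ E ∣ C j) (∣ X ∩ E ∣ C i) _))
                 (cong (_* (∣ Y ∩ E ∣ C j)) (nCk+nC[k+1]≡[n+1]C[k+1] ∣ X ∩ E ∣ i)))
  newPoint false true true i zero m _ i+j≡m =
    trans (vanishing λ S → cong (λ b → indicator b * _) (∧-zeroʳ (∣ S ∩ X ∣ ≡ᵇ i))) (IH i zero m i+j≡m)
  newPoint false true true i (suc j) m _ i+j≡m with refl ← trans (sym (ℕ.+-suc i j)) i+j≡m =
    trans (cong₂ _+_ (IH i j (i + j) refl) (IH i (suc j) m i+j≡m))
          (trans (sym (ℕ.*-distribˡ-+ (∣ X ∩ E ∣ C i) _ _))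
                 (cong ((∣ X ∩ E ∣ C i) *_) (nCk+nC[k+1]≡[n+1]C[k+1] ∣ Y ∩ E ∣ j)))

sumℕ-split-mSubsetsOf : ∀ {n} (E X Y : Subset n) {i j m} → X ∩ Y ≡ ⊥ → i + j ≡ m →
  sumℕ (split X Y i j) (mSubsetsOf m E) ≡ (∣ X ∩ E ∣ C i) * (∣ Y ∩ E ∣ C j)
sumℕ-split-mSubsetsOf {n} E X Y {i} {j} {m} X∩Y≡⊥ i+j≡m =
  trans (sumℕ-filter _ (split X Y i j) (allSubsets n)) (sumℕ-splitOfSizeIn n E X Y i j m X∩Y≡⊥ i+j≡m)

sumℕ-split-mSubsets : ∀ {n} (X Y : Subset n) {i j m} → X ∩ Y ≡ ⊥ → i + j ≡ m →
  sumℕ (split X Y i j) (mSubsets m) ≡ (∣ X ∣ C i) * (∣ Y ∣ C j)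
sumℕ-split-mSubsets {n} X Y {i} {j} {m} X∩Y≡⊥ i+j≡m = begin
  sumℕ (split X Y i j) (mSubsets m)
    ≡⟨ sumℕ-filter _ (split X Y i j) (allSubsets n) ⟩
  sumℕ (λ S → split X Y i j S * indicator (does (∣ S ∣ ≟ m))) (allSubsets n)
    ≡⟨ sumℕ-cong (λ S → cong (λ b → split X Y i j S * indicator b) (inside⊤ S)) (allSubsets n) ⟩
  sumℕ (splitOfSizeIn ⊤ X Y i j m) (allSubsets n)
    ≡⟨ sumℕ-splitOfSizeIn n ⊤ X Y i j m X∩Y≡⊥ i+j≡m ⟩
  (∣ X ∩ ⊤ ∣ C i) * (∣ Y ∩ ⊤ ∣ C j)
    ≡⟨ cong₂ (λ X′ Y′ → (∣ X′ ∣ C i) * (∣ Y′ ∣ C j)) (∩-identityʳ X) (∩-identityʳ Y) ⟩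
  (∣ X ∣ C i) * (∣ Y ∣ C j) ∎
  where
  open ≡-Reasoning
  inside⊤ : ∀ S → does (∣ S ∣ ≟ m) ≡ does (∣ S ∣ ≟ m) ∧ does (S ⊆? ⊤)
  inside⊤ S = sym (trans (cong (does (∣ S ∣ ≟ m) ∧_) (dec-true (S ⊆? ⊤) ⊆⊤)) (∧-identityʳ _))

record Block : Set where
  constructor block
  field
    weight inX inY : ℕ

open Block

blockWeight : ∀ {n} → Subset n → Subset n → List Block → Subset n → ℕ
blockWeight X Y bs S = sumℕ (λ b → weight b * split X Y (inX b) (inY b) S) bs

blockCount : List Block → ℕ → ℕ → ℕ
blockCount bs α δ = sumℕ (λ b → weight b * ((α C inX b) * (δ C inY b))) bs

sumℕ-blockWeight : ∀ {n} (X Y : Subset n) (bs : List Block) (L : List (Subset n)) {α δ} →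
  All (λ b → sumℕ (split X Y (inX b) (inY b)) L ≡ (α C inX b) * (δ C inY b)) bs →
  sumℕ (blockWeight X Y bs) L ≡ blockCount bs α δ
sumℕ-blockWeight X Y [] L [] = sumℕ-zero L
sumℕ-blockWeight X Y (b ∷ bs) L (count ∷ counts) =
  trans (sumℕ-+ (λ S → weight b * split X Y (inX b) (inY b) S) (blockWeight X Y bs) L)
        (cong₂ _+_ (trans (sumℕ-* (weight b) _ L) (cong (weight b *_) count)) (sumℕ-blockWeight X Y bs L counts))

≤blockCount : ∀ {b c} bs α δ → b ∈ bs → c ≤ (α C inX b) * (δ C inY b) → weight b * c ≤ blockCount bs α δ
≤blockCount (b ∷ _) α δ (here refl) c≤ = ℕ.≤-trans (ℕ.*-monoʳ-≤ (weight b) c≤) (ℕ.m≤m+n _ _)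
≤blockCount (_ ∷ bs) α δ (there b∈bs) c≤ = ℕ.≤-trans (≤blockCount bs α δ b∈bs c≤) (ℕ.m≤n+m _ _)

module _ {k} (H : UniformHypergraph k) where
  open UniformHypergraph H

  ∣edge∣ : ∀ {e} → e ∈ edges → ∣ e ∣ ≡ k
  ∣edge∣ = All.lookup uniform

  pairwiseMeeting : ∀ {m} → m ≤ k → (∀ M → IsMatching H m M → length M ≤ 1) →
    ∀ {e f} → e ∈ edges → f ∈ edges → m ≤ ∣ e ∩ f ∣
  pairwiseMeeting {m} m≤k atMostOne {e} {f} e∈ f∈ with Vec.≡-dec Bool._≟_ e f | m ≤? ∣ e ∩ f ∣
  ... | yes refl | _ = subst (m ≤_) (sym (trans (cong ∣_∣ (∩-idem e)) (∣edge∣ e∈))) m≤k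
  ... | no _ | yes m≤∣e∩f∣ = m≤∣e∩f∣
  ... | no e≢f | no m≰∣e∩f∣ = contradiction (atMostOne (e ∷ f ∷ []) pair) λ { (s≤s ()) }
    where
    meetSmall : ∀ {x y} → x ∈ e ∷ f ∷ [] → y ∈ e ∷ f ∷ [] → x ≢ y → ∣ x ∩ y ∣ < m
    meetSmall (here refl) (here refl) x≢y = contradiction refl x≢y
    meetSmall (here refl) (there (here refl)) _ = ℕ.≰⇒> m≰∣e∩f∣
    meetSmall (there (here refl)) (here refl) _ = subst (_< m) (cong ∣_∣ (∩-comm e f)) (ℕ.≰⇒> m≰∣e∩f∣)
    meetSmall (there (here refl)) (there (here refl)) x≢y = contradiction refl x≢y
    pair : IsMatching H m (e ∷ f ∷ [])
    pair = ((e≢f ∷ []) ∷ [] ∷ []) , (e∈ ∷ f∈ ∷ []) , meetSmall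

  blockCover : ∀ m (X Y : Subset n) → X ∩ Y ≡ ⊥ → (bs : List Block) → All (λ b → inX b + inY b ≡ m) bs →
    ∀ d .{{_ : NonZero d}} → (∀ {f} → f ∈ edges → d ≤ blockCount bs ∣ X ∩ f ∣ ∣ Y ∩ f ∣) →
    ∀ {β} → + blockCount bs ∣ X ∣ ∣ Y ∣ / d ≤ℚ β → FracCoverNumberAtMost H m β
  blockCover m X Y X∩Y≡⊥ bs sizes d covers {β} size≤β = c , (nonNegative , All.tabulate covered) , size≤
    where
    c : Subset n → ℚ
    c S = + blockWeight X Y bs S / d
    nonNegative : ∀ S → ∣ S ∣ ≡ m → 0ℚ ≤ℚ c S
    nonNegative S _ = 0≤/ (blockWeight X Y bs S) d
    covered : ∀ {f} → f ∈ edges → 1ℚ ≤ℚ sumℚ c (mSubsetsOf m f)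
    covered {f} f∈ = subst (1ℚ ≤ℚ_)
      (sym (trans (sumℚ-/ (blockWeight X Y bs) d (mSubsetsOf m f)) (cong (λ x → + x / d)
        (sumℕ-blockWeight X Y bs (mSubsetsOf m f) (All.map (λ {b} → sumℕ-split-mSubsetsOf f X Y {inX b} {inY b} X∩Y≡⊥) sizes)))))
      (1≤/ _ d (covers f∈))
    size≤ : coverSize H m c ≤ℚ β
    size≤ = subst (_≤ℚ β)
      (sym (trans (sumℚ-/ (blockWeight X Y bs) d (mSubsets m)) (cong (λ x → + x / d)
        (sumℕ-blockWeight X Y bs (mSubsets m) (All.map (λ {b} → sumℕ-split-mSubsets X Y {inX b} {inY b} X∩Y≡⊥) sizes)))))
      size≤β

m+k≡n⇒m≤n : ∀ {m n} k → m + k ≡ n → m ≤ n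
m+k≡n⇒m≤n {m} k refl = ℕ.m≤m+n m k

coreBlocks : ℕ → List Block
coreBlocks t = block 1 (suc t) 0 ∷ []

coreBlocks-covers : ∀ {t α} δ → suc t ≤ α → 1 ≤ blockCount (coreBlocks t) α δ
coreBlocks-covers {α = α} δ t<α = ≤blockCount (coreBlocks _) α δ (here refl) (ℕ.≤-trans (k≤n⇒nCk>0 t<α) (ℕ.m≤m*n _ 1))

coreBlocks-size : ∀ t δ → blockCount (coreBlocks t) (2 + t) δ * 6 ≤ (suc t C 2 + (2 * t + 3) * 6) * 1
coreBlocks-size t δ = begin
  blockCount (coreBlocks t) (2 + t) δ * 6   ≡⟨ cong (λ x → (1 * (x * 1) + 0) * 6) ([1+n]Cn≡1+n (suc t)) ⟩
  (1 * ((2 + t) * 1) + 0) * 6              ≤⟨ m+k≡n⇒m≤n (c + 6 * t + 6) (slack c t) ⟩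
  (c + (2 * t + 3) * 6) * 1                ∎
  where
  open ℕ.≤-Reasoning
  c = suc t C 2
  slack : ∀ c t → (1 * ((2 + t) * 1) + 0) * 6 + (c + 6 * t + 6) ≡ (c + (2 * t + 3) * 6) * 1
  slack = solve-∀

-- The ways an edge f can meet C = e ∩ e′ and D = e △ e′ (indices t, |C ∩ f|, |D ∩ f|), given
-- |C| = t + 1, |D| = 4 and |f ∩ e|, |f ∩ e′| ≥ t + 1.

data Profile : ℕ → ℕ → ℕ → Set where
  full : ∀ {t δ} → Profile t (suc t) δ
  mid  : ∀ {t δ} → 2 ≤ δ → Profile t t δ
  low  : ∀ {a} → Profile (suc a) a 4

Profile-suc : ∀ {t α δ} → Profile t α δ → Profile (suc t) (suc α) δ
Profile-suc full = full
Profile-suc (mid 2≤δ) = mid 2≤δ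
Profile-suc low = low

profile : ∀ t α {β γ} → suc t ≤ α + β → suc t ≤ α + γ → β ≤ 2 → γ ≤ 2 → α ≤ suc t → Profile t α (β + γ)
profile zero zero 1≤β 1≤γ _ _ _ = mid (ℕ.+-mono-≤ 1≤β 1≤γ)
profile (suc zero) zero 2≤β 2≤γ β≤2 γ≤2 _ with refl ← ℕ.≤-antisym β≤2 2≤β | refl ← ℕ.≤-antisym γ≤2 2≤γ = low
profile (suc (suc t)) zero t<β _ β≤2 _ _ with s≤s (s≤s ()) ← ℕ.≤-trans t<β β≤2
profile zero (suc zero) _ _ _ _ _ = full
profile zero (suc (suc α)) _ _ _ _ (s≤s ())
profile (suc t) (suc α) (s≤s t<α+β) (s≤s t<α+γ) β≤2 γ≤2 (s≤s α≤t) =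
  Profile-suc (profile t α t<α+β t<α+γ β≤2 γ≤2 α≤t)

pairBlocks : ℕ → List Block
pairBlocks t = block 2 (suc t) 0 ∷ block 1 t 1 ∷ []

2≤[t]Ct*[δ]C1 : ∀ t δ → 2 ≤ δ → 2 ≤ (t C t) * (δ C 1)
2≤[t]Ct*[δ]C1 t δ 2≤δ = subst (2 ≤_) (sym (trans (cong₂ _*_ (nCn≡1 t) (nC1≡n δ)) (ℕ.*-identityˡ δ))) 2≤δ

pairBlocks-covers : ∀ {t α δ} → Profile t α δ → δ ≢ 4 → 2 ≤ blockCount (pairBlocks t) α δ
pairBlocks-covers {t} {δ = δ} full _ =
  ≤blockCount (pairBlocks t) (suc t) δ (here refl) (ℕ.≤-trans (k≤n⇒nCk>0 {suc t} ℕ.≤-refl) (ℕ.m≤m*n (suc t C suc t) 1))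
pairBlocks-covers {t} {δ = δ} (mid 2≤δ) _ = ≤blockCount (pairBlocks t) t δ (there (here refl)) (2≤[t]Ct*[δ]C1 t δ 2≤δ)
pairBlocks-covers low δ≢4 = contradiction refl δ≢4

pairBlocks-size : ∀ t → blockCount (pairBlocks t) (suc t) 4 * 6 ≤ (suc t C 2 + (2 * t + 3) * 6) * 2
pairBlocks-size t = begin
  blockCount (pairBlocks t) (suc t) 4 * 6       ≡⟨ cong₂ (λ x y → (2 * (x * 1) + (1 * (y * 4) + 0)) * 6) (nCn≡1 (suc t)) ([1+n]Cn≡1+n t) ⟩
  (2 * (1 * 1) + (1 * (suc t * 4) + 0)) * 6     ≤⟨ m+k≡n⇒m≤n (2 * c) (slack c t) ⟩
  (c + (2 * t + 3) * 6) * 2                     ∎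
  where
  open ℕ.≤-Reasoning
  c = suc t C 2
  slack : ∀ c t → (2 * (1 * 1) + (1 * (suc t * 4) + 0)) * 6 + 2 * c ≡ (c + (2 * t + 3) * 6) * 2
  slack = solve-∀

-- The block for the edges f with |C ∩ f| = t - 1 and D ⊆ f takes i points from C and j from D.
-- For t ≥ 3 we use i = t - 3 and j = 4: by 6 C(t+1, 4) = C(t+1, 2) C(t-1, 2) it costs exactly
-- (1/6) C(t+1, 2) = (1/6) C(k-2, 2). For t ≤ 2 we use i = 0, which costs 1 (for t = 0 there
-- are no such edges).

record LowBlock (t : ℕ) : Set where
  field
    i j     : ℕ
    i+j≡1+t : i + j ≡ suc t
    j≤4     : j ≤ 4
    i≤t∸1   : i ≤ t ∸ 1
    ratio   : 6 * (suc t C i) ≤ (suc t C 2 + 6) * ((t ∸ 1) C i)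

smallLowBlock : ∀ t → t ≤ 2 → LowBlock t
smallLowBlock t t≤2 = record
  { i = 0 ; j = suc t ; i+j≡1+t = refl ; j≤4 = s≤s (ℕ.≤-trans t≤2 (ℕ.n≤1+n 2)) ; i≤t∸1 = z≤n
  ; ratio = ℕ.≤-trans (ℕ.m≤n+m 6 (suc t C 2)) (ℕ.m≤m*n _ 1) }

lowBlock : ∀ t → LowBlock t
lowBlock 0 = smallLowBlock 0 z≤n
lowBlock 1 = smallLowBlock 1 (s≤s z≤n)
lowBlock 2 = smallLowBlock 2 (s≤s (s≤s z≤n))
lowBlock (suc (suc (suc a))) = record
  { i = a ; j = 4 ; i+j≡1+t = ℕ.+-comm a 4 ; j≤4 = ℕ.≤-refl ; i≤t∸1 = ℕ.m≤n+m a 2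
  ; ratio = subst₂ (λ x y → 6 * x ≤ ((4 + a) C 2 + 6) * y) (sym ([k+a]Ca≡[k+a]Ck 4 a)) (sym ([k+a]Ca≡[k+a]Ck 2 a))
      (subst (_≤ ((4 + a) C 2 + 6) * ((2 + a) C 2)) (sym (6*[4+a]C4≡[4+a]C2*[2+a]C2 a))
        (ℕ.*-monoˡ-≤ ((2 + a) C 2) (ℕ.m≤m+n ((4 + a) C 2) 6))) }

module _ {t} (L : LowBlock t) where
  open LowBlock L

  lowWeight : ℕ
  lowWeight = ((t ∸ 1) C i) * (4 C j)

  pairLowBlocks : List Block
  pairLowBlocks = block lowWeight t 1 ∷ block 2 i j ∷ []

pairLowBlocks-covers : ∀ {t α δ} (L : LowBlock t) → Profile t α δ → 2 ≤ δ →
  lowWeight L * 2 ≤ blockCount (pairLowBlocks L) α δ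
pairLowBlocks-covers {t} {δ = δ} L full 2≤δ = ≤blockCount (pairLowBlocks L) (suc t) δ (here refl)
  (subst (2 ≤_) (sym (cong₂ _*_ ([1+n]Cn≡1+n t) (nC1≡n δ))) (ℕ.≤-trans 2≤δ (ℕ.m≤n*m δ (suc t))))
pairLowBlocks-covers {t} {δ = δ} L (mid 2≤δ) _ = ≤blockCount (pairLowBlocks L) t δ (here refl) (2≤[t]Ct*[δ]C1 t δ 2≤δ)
pairLowBlocks-covers {suc a} L low _ = subst (_≤ blockCount (pairLowBlocks L) a 4) (ℕ.*-comm 2 (lowWeight L))
  (≤blockCount (pairLowBlocks L) a 4 (there (here refl)) ℕ.≤-refl)

pairLowBlocks-size : ∀ t (L : LowBlock t) →
  blockCount (pairLowBlocks L) (suc t) 4 * 6 ≤ (suc t C 2 + (2 * t + 3) * 6) * (lowWeight L * 2)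
pairLowBlocks-size t L = begin
  blockCount (pairLowBlocks L) (suc t) 4 * 6      ≡⟨ cong (λ w → (x * z * (w * 4) + (2 * (y * z) + 0)) * 6) ([1+n]Cn≡1+n t) ⟩
  (x * z * (suc t * 4) + (2 * (y * z) + 0)) * 6   ≡⟨ regroupˡ t x y z ⟩
  24 * (x * z) * suc t + 2 * (6 * y) * z          ≤⟨ ℕ.+-monoʳ-≤ (24 * (x * z) * suc t) (ℕ.*-monoˡ-≤ z (ℕ.*-monoʳ-≤ 2 ratio)) ⟩
  24 * (x * z) * suc t + 2 * ((c + 6) * x) * z    ≡⟨ regroupʳ t c x z ⟩
  (c + (2 * t + 3) * 6) * (x * z * 2)             ∎
  where
  open LowBlock L
  open ℕ.≤-Reasoning
  x = (t ∸ 1) C i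
  y = suc t C i
  z = 4 C j
  c = suc t C 2
  regroupˡ : ∀ t x y z → (x * z * (suc t * 4) + (2 * (y * z) + 0)) * 6 ≡ 24 * (x * z) * suc t + 2 * (6 * y) * z
  regroupˡ = solve-∀
  regroupʳ : ∀ t c x z → 24 * (x * z) * suc t + 2 * ((c + 6) * x) * z ≡ (c + (2 * t + 3) * 6) * (x * z * 2)
  regroupʳ = solve-∀

module _ (t : ℕ) (H : UniformHypergraph (3 + t)) where
  open UniformHypergraph H

  module _ (meets : ∀ {e f} → e ∈ edges → f ∈ edges → suc t ≤ ∣ e ∩ f ∣) where

    coreCover : ∀ {e} → e ∈ edges → (∀ {f} → f ∈ edges → ∣ e ∩ f ∣ ≢ suc t) →
      FracCoverNumberAtMost H (suc t) (bound (3 + t))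
    coreCover {e} e∈ noExactMeet =
      blockCover H (suc t) K ⊥ (∩-zeroʳ K) (coreBlocks t) (ℕ.+-identityʳ (suc t) ∷ []) 1
        (λ {f} f∈ → coreBlocks-covers ∣ ⊥ ∩ f ∣ (t<∣K∩f∣ f∈))
        (/≤bound t (blockCount (coreBlocks t) ∣ K ∣ ∣ ⊥ {n} ∣) 1
          (subst (λ κ → blockCount (coreBlocks t) κ ∣ ⊥ {n} ∣ * 6 ≤ _) (sym ∣K∣) (coreBlocks-size t ∣ ⊥ {n} ∣)))
      where
      K : Subset n
      K = dropFirst e
      t<∣K∩f∣ : ∀ {f} → f ∈ edges → suc t ≤ ∣ K ∩ f ∣
      t<∣K∩f∣ {f} f∈ = ℕ.s≤s⁻¹ (ℕ.≤-trans (ℕ.≤∧≢⇒< (meets e∈ f∈) (λ t≡ → noExactMeet f∈ (sym t≡)))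
                                          (∣p∩q∣≤1+∣dropFirst[p]∩q∣ e f))
      ∣K∣ : ∣ K ∣ ≡ 2 + t
      ∣K∣ = ℕ.suc-injective (trans (∣dropFirst∣ e (subst (1 ≤_) (sym (∣edge∣ H e∈)) (s≤s z≤n))) (∣edge∣ H e∈))

    module _ {e e′} (e∈ : e ∈ edges) (e′∈ : e′ ∈ edges) (∣e∩e′∣ : ∣ e ∩ e′ ∣ ≡ suc t) where

      private
        ∣e△e′∣ : ∣ e △ e′ ∣ ≡ 4
        ∣e△e′∣ = ℕ.+-cancelʳ-≡ (suc t + suc t) ∣ e △ e′ ∣ 4 (begin
          ∣ e △ e′ ∣ + (suc t + suc t)            ≡⟨ cong (λ c → ∣ e △ e′ ∣ + (c + c)) (sym ∣e∩e′∣) ⟩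
          ∣ e △ e′ ∣ + (∣ e ∩ e′ ∣ + ∣ e ∩ e′ ∣)  ≡⟨ ∣e△e′∣+2∣e∩e′∣≡∣e∣+∣e′∣ e e′ ⟩
          ∣ e ∣ + ∣ e′ ∣                          ≡⟨ cong₂ _+_ (∣edge∣ H e∈) (∣edge∣ H e′∈) ⟩
          (3 + t) + (3 + t)                       ≡⟨ regroup t ⟩
          4 + (suc t + suc t)                     ∎)
          where
          open ≡-Reasoning
          regroup : ∀ t → (3 + t) + (3 + t) ≡ 4 + (suc t + suc t)
          regroup = solve-∀

        ≤2 : ∀ {x y} → x + ∣ e ∩ e′ ∣ ≤ ∣ y ∣ → y ∈ edges → x ≤ 2
        ≤2 {x} x+∣e∩e′∣≤∣y∣ y∈ = ℕ.+-cancelʳ-≤ (suc t) x 2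
          (subst₂ (λ c d → x + c ≤ d) ∣e∩e′∣ (∣edge∣ H y∈) x+∣e∩e′∣≤∣y∣)

        profileOf : ∀ {f} → f ∈ edges → Profile t ∣ (e ∩ e′) ∩ f ∣ ∣ (e △ e′) ∩ f ∣
        profileOf {f} f∈ = subst (Profile t _) (sym (∣e△e′∩f∣≡∣e∖e′∩f∣+∣e′∖e∩f∣ e e′ f)) (profile t _
          (ℕ.≤-trans (meets e∈ f∈) (∣e∩f∣≤∣e∩e′∩f∣+∣e∖e′∩f∣ e e′ f))
          (ℕ.≤-trans (meets e′∈ f∈) (∣e′∩f∣≤∣e∩e′∩f∣+∣e′∖e∩f∣ e e′ f))
          (≤2 (∣e∖e′∩f∣+∣e∩e′∣≤∣e∣ e e′ f) e∈)
          (≤2 (∣e′∖e∩f∣+∣e∩e′∣≤∣e′∣ e e′ f) e′∈)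
          (subst (∣ (e ∩ e′) ∩ f ∣ ≤_) ∣e∩e′∣ (∣p∩q∣≤∣p∣ (e ∩ e′) f)))

        size≤bound : ∀ bs d .{{_ : NonZero d}} → blockCount bs (suc t) 4 * 6 ≤ (suc t C 2 + (2 * t + 3) * 6) * d →
          + blockCount bs ∣ e ∩ e′ ∣ ∣ e △ e′ ∣ / d ≤ℚ bound (3 + t)
        size≤bound bs d size≤ = /≤bound t (blockCount bs ∣ e ∩ e′ ∣ ∣ e △ e′ ∣) d
          (subst₂ (λ α δ → blockCount bs α δ * 6 ≤ _) (sym ∣e∩e′∣) (sym ∣e△e′∣) size≤)

      pairCover : (∀ {g} → g ∈ edges → ∣ (e △ e′) ∩ g ∣ ≢ 4) → FracCoverNumberAtMost H (suc t) (bound (3 + t))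
      pairCover noneContains△ =
        blockCover H (suc t) (e ∩ e′) (e △ e′) (e∩e′∩[e△e′]≡⊥ e e′) (pairBlocks t)
          (ℕ.+-identityʳ (suc t) ∷ ℕ.+-comm t 1 ∷ []) 2
          (λ f∈ → pairBlocks-covers (profileOf f∈) (noneContains△ f∈))
          (size≤bound (pairBlocks t) 2 (pairBlocks-size t))

      pairLowCover : ∀ {g} → g ∈ edges → ∣ (e △ e′) ∩ g ∣ ≡ 4 → FracCoverNumberAtMost H (suc t) (bound (3 + t))
      pairLowCover {g} g∈ ∣e△e′∩g∣ =
        blockCover H (suc t) (e ∩ e′) (e △ e′) (e∩e′∩[e△e′]≡⊥ e e′) (pairLowBlocks L)
          (ℕ.+-comm t 1 ∷ i+j≡1+t ∷ []) (lowWeight L * 2)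
          (λ f∈ → pairLowBlocks-covers L (profileOf f∈) (2≤∣e△e′∩f∣ f∈))
          (size≤bound (pairLowBlocks L) (lowWeight L * 2) (pairLowBlocks-size t L))
        where
        L = lowBlock t
        open LowBlock L
        instance
          lowWeight≢0 : NonZero (lowWeight L)
          lowWeight≢0 = ℕ.>-nonZero (ℕ.*-mono-≤ (k≤n⇒nCk>0 i≤t∸1) (k≤n⇒nCk>0 j≤4))
          lowWeight*2≢0 : NonZero (lowWeight L * 2)
          lowWeight*2≢0 = ℕ.m*n≢0 (lowWeight L) 2
        2≤∣e△e′∩f∣ : ∀ {f} → f ∈ edges → 2 ≤ ∣ (e △ e′) ∩ f ∣
        2≤∣e△e′∩f∣ {f} f∈ = ℕ.+-cancelˡ-≤ (3 + t) 2 _ (begin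
          3 + t + 2                       ≡⟨ regroup t ⟩
          suc t + 4                       ≤⟨ ℕ.+-mono-≤ (meets f∈ g∈) (ℕ.≤-reflexive (sym ∣e△e′∩g∣)) ⟩
          ∣ f ∩ g ∣ + ∣ (e △ e′) ∩ g ∣      ≤⟨ ∣f∩g∣+∣e△e′∩g∣≤∣g∣+∣e△e′∩f∣ e e′ f g ⟩
          ∣ g ∣ + ∣ (e △ e′) ∩ f ∣          ≡⟨ cong (_+ ∣ (e △ e′) ∩ f ∣) (∣edge∣ H g∈) ⟩
          3 + t + ∣ (e △ e′) ∩ f ∣          ∎)
          where
          open ℕ.≤-Reasoning
          regroup : ∀ t → 3 + t + 2 ≡ suc t + 4
          regroup = solve-∀

    cover : ∀ {e} → e ∈ edges → FracCoverNumberAtMost H (suc t) (bound (3 + t))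
    cover {e} e∈ with any? (λ f → ∣ e ∩ f ∣ ≟ suc t) edges
    ... | no noExactMeet = coreCover e∈ (All.lookup (¬Any⇒All¬ edges noExactMeet))
    ... | yes exactMeet with find exactMeet
    ...   | e′ , e′∈ , ∣e∩e′∣ with any? (λ g → ∣ (e △ e′) ∩ g ∣ ≟ 4) edges
    ...     | no noneContains△ = pairCover e∈ e′∈ ∣e∩e′∣ (All.lookup (¬Any⇒All¬ edges noneContains△))
    ...     | yes someContains△ with find someContains△
    ...       | g , g∈ , ∣e△e′∩g∣ = pairLowCover e∈ e′∈ ∣e∩e′∣ g∈ ∣e△e′∩g∣

theorem7 : (k : ℕ) → 3 ≤ k → (H : UniformHypergraph k) →
    MatchingNumberOne H (k ∸ 2) → FracCoverNumberAtMost H (k ∸ 2) (bound k)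
theorem7 0 ()
theorem7 1 (s≤s ())
theorem7 2 (s≤s (s≤s ()))
theorem7 (suc (suc (suc t))) _ H ((e ∷ [] , (_ , e∈ ∷ [] , _) , _) , atMostOne) =
  cover t H (pairwiseMeeting H (ℕ.≤-trans (ℕ.n≤1+n _) (ℕ.n≤1+n _)) atMostOne) e∈
theorem7 (suc (suc (suc t))) _ H (([] , _ , ()) , _)
theorem7 (suc (suc (suc t))) _ H ((_ ∷ _ ∷ _ , _ , ()) , _)
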